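{- Let $\lambda=(m,n)$ be a triangular $2$-partition and $\theta$ the $i$-row-regular tableau on $\lambda$. Then for every integer $k$ with $n+i\le k\le m+n$, the subpartition $\mu$ formed by the cells of $\lambda$ with labels at most $k$ is a triangular $2$-partition, and the restriction of $\theta$ to $\mu$ is a row-regular tableau of $\mu$.
   Context: A $2$-partition $(m,n)$ has $m\ge n\ge0$: a bottom row of $m$ cells and an upper row of $n$ cells (French convention). A partition is triangular if there exist positive reals $r,s$ with $\lambda_j=\lfloor r-jr/s\rfloor$ for integers $1\le j\le s$ and $\lambda_j=0$ for $j>s$. For a triangular $2$-partition $(m,n)$ and $1\le i\le m-2(n-1)$, the $i$-row-regular tableau is the standard Young tableau whose upper-row labels are $n+i,n+i+2,\dots,n+i+2(n-1)$; a row-regular tableau is an $i$-row-regular tableau for some such $i$.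
   Formalization: In the definition of a triangular partition, the numbers r, s range over the positive rationals rather than the positive reals. -}

module Defs where

open import Data.Nat as ℕ using (ℕ; zero; suc; _+_; _*_; _≤_; _≤ᵇ_)
open import Data.Integer as ℤ using (ℤ; +_)
open import Data.Rational as ℚ using (ℚ; Positive; floor; _÷_; 0ℚ)
open import Data.Rational.Properties using (pos⇒nonZero)
open import Data.List using (List; map; filter; upTo; length; applyUpTo)
open import Data.List.Membership.DecPropositional (ℕ._≟_) using (_∈?_)
open import Data.Product using (Σ; _×_)
open import Relation.Binary.PropositionalEquality using (_≡_)
open import Relation.Nullary using (¬?)
open import Data.Nat using (_≤?_)

ι : ℕ → ℚ
ι j = (+ j) ℚ./ 1

TriangularSeq : (ℕ → ℕ) → Set
TriangularSeq λ' =
  Σ ℚ λ r → Σ ℚ λ s → Σ (Positive r) λ _ → Σ (Positive s) λ ps →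
    ((j : ℕ) → 1 ≤ j →
       (ι j ℚ.≤ s → floor (r ℚ.- (_÷_ (ι j ℚ.* r) s {{pos⇒nonZero s {{ps}}}})) ≡ + λ' j)
     × (s ℚ.< ι j → λ' j ≡ 0))

parts2 : ℕ → ℕ → ℕ → ℕ
parts2 m n 1 = m
parts2 m n 2 = n
parts2 m n _ = 0

Triangular2 : ℕ → ℕ → Set
Triangular2 m n = n ≤ m × TriangularSeq (parts2 m n)

-- A standard Young tableau of two-row shape, given by the increasing
-- list of labels of its bottom row and of its upper row.
record Tableau2 : Set where
  constructor tab
  field
    bottom : List ℕ
    upper  : List ℕ

labels : ℕ → List ℕ
labels N = applyUpTo suc N

upperRR : ℕ → ℕ → List ℕ
upperRR n i = map (λ t → n + i + 2 * t) (upTo n)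

rowRegular : ℕ → ℕ → ℕ → Tableau2
rowRegular m n i =
  tab (filter (λ x → ¬? (x ∈? upperRR n i)) (labels (m + n))) (upperRR n i)

-- admissible indices: 1 ≤ i ≤ m - 2(n-1), i.e. 1 ≤ i and i + 2n ≤ m + 2
ValidIndex : ℕ → ℕ → ℕ → Set
ValidIndex m n i = 1 ≤ i × i + 2 * n ≤ m + 2

restrict : ℕ → Tableau2 → Tableau2
restrict k (tab b u) = tab (filter (_≤? k) b) (filter (_≤? k) u)

rowLen₁ rowLen₂ : Tableau2 → ℕ
rowLen₁ (tab b u) = length b
rowLen₂ (tab b u) = length u

{-# OPTIONS --safe #-}
-- Restricting the i-row-regular tableau of (m, n) to the labels ≤ k keeps an
-- initial segment n+i, n+i+2, …, n+i+2(p-1) of its upper row and all labels ≤ k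
-- of its bottom row, so it is the (n+i-p)-row-regular tableau of (k-p, p); since
-- the last kept upper label is at most k, n+i+2p ≤ k+2, which makes that index
-- admissible. A shape (m′, n′) with an admissible index has 2n′ ≤ m′+1, and every
-- 2-partition (m, n) with 2n ≤ m+1 is triangular: for the slope d = m-n+½,
-- r = n+2d and s = r/d, the values r - jd are m+½ and n for j = 1, 2, and lie
-- in [0, ½] for the remaining j ≤ s.
module Submission where

open import Defs
open import Data.Nat as ℕ using (ℕ; zero; suc)
import Data.Nat.Properties as ℕ
open import Data.Product using (Σ; _×_; _,_; proj₁)
open import Data.Empty using (⊥-elim)
open import Relation.Binary.PropositionalEquality hiding ([_])

module TriangularShapes where
  open import Data.Nat.DivMod using (m<n*o⇒m/o<n; /-monoˡ-≤; m*n/n≡m)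
  import Data.Nat.Tactic.RingSolver as ℕ-Solver
  open import Data.List using ([]; _∷_)
  open import Data.Integer as ℤ using (+_)
  import Data.Integer.Properties as ℤ
  import Data.Integer.DivMod as ℤ
  open import Data.Rational
    using (ℚ; mkℚ; toℚᵘ; floor; 0ℚ; 1ℚ; ½; _+_; _*_; _-_; -_; _≤_; _<_; _÷_; 1/_; Positive; NonNegative; NonZero)
  open import Data.Rational.Properties
  open import Data.Rational.Solver using (module +-*-Solver)
  open import Data.Rational.Unnormalised as ℚᵘ using (mkℚᵘ; *≡*)
  import Data.Rational.Unnormalised.Properties as ℚᵘ
  open import Relation.Nullary.Decidable using (from-yes)

  k*n≤m<[1+k]*n⇒m/n≡k : ∀ {m n k} .{{_ : ℕ.NonZero n}} → k ℕ.* n ℕ.≤ m → m ℕ.< suc k ℕ.* n → m ℕ./ n ≡ k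
  k*n≤m<[1+k]*n⇒m/n≡k {m} {n} {k} lower upper = ℕ.≤-antisym
    (ℕ.<⇒≤pred (m<n*o⇒m/o<n upper))
    (subst (ℕ._≤ m ℕ./ n) (m*n/n≡m k n) (/-monoˡ-≤ n lower))

  toℚᵘ-ι : ∀ a → toℚᵘ (ι a) ℚᵘ.≃ mkℚᵘ (+ a) 0
  toℚᵘ-ι a = toℚᵘ-fromℚᵘ (mkℚᵘ (+ a) 0)

  ι-homo-+ : ∀ a b → ι (a ℕ.+ b) ≡ ι a + ι b
  ι-homo-+ a b = toℚᵘ-injective (begin
    toℚᵘ (ι (a ℕ.+ b))              ≈⟨ toℚᵘ-ι (a ℕ.+ b) ⟩
    mkℚᵘ (+ (a ℕ.+ b)) 0            ≈⟨ *≡* (cong (ℤ._* + 1) numerator) ⟩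
    mkℚᵘ (+ a) 0 ℚᵘ.+ mkℚᵘ (+ b) 0 ≈⟨ ℚᵘ.+-cong (ℚᵘ.≃-sym (toℚᵘ-ι a)) (ℚᵘ.≃-sym (toℚᵘ-ι b)) ⟩
    toℚᵘ (ι a) ℚᵘ.+ toℚᵘ (ι b)     ≈⟨ ℚᵘ.≃-sym (toℚᵘ-homo-+ (ι a) (ι b)) ⟩
    toℚᵘ (ι a + ι b)               ∎)
    where
    open ℚᵘ.≃-Reasoning
    numerator : + (a ℕ.+ b) ≡ + a ℤ.* + 1 ℤ.+ + b ℤ.* + 1
    numerator = trans (ℤ.pos-+ a b) (sym (cong₂ ℤ._+_ (ℤ.*-identityʳ (+ a)) (ℤ.*-identityʳ (+ b))))

  ι-nonNeg : ∀ a → NonNegative (ι a)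
  ι-nonNeg a = normalize-nonNeg a 1

  0≤ι : ∀ a → 0ℚ ≤ ι a
  0≤ι a = nonNegative⁻¹ (ι a) {{ι-nonNeg a}}

  floor-unique : ∀ z q → ι z ≤ q → q < ι (suc z) → floor q ≡ + z
  floor-unique z (mkℚ n d-1 _) z≤q q<1+z = floor-num n
    (subst₂ ℤ._≤_ (sym (ℤ.pos-* z (suc d-1))) (ℤ.*-identityʳ n)
      (ℚᵘ.drop-*≤* (ℚᵘ.≤-respˡ-≃ (toℚᵘ-ι z) (toℚᵘ-mono-≤ z≤q))))
    (subst₂ ℤ._<_ (ℤ.*-identityʳ n) (sym (ℤ.pos-* (suc z) (suc d-1)))
      (ℚᵘ.drop-*<* (ℚᵘ.<-respʳ-≃ (toℚᵘ-ι (suc z)) (toℚᵘ-mono-< q<1+z))))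
    where
    floor-num : ∀ n → + (z ℕ.* suc d-1) ℤ.≤ n → n ℤ.< + (suc z ℕ.* suc d-1) → n ℤ./ + suc d-1 ≡ + z
    floor-num (+ a) (ℤ.+≤+ lower) (ℤ.+<+ upper) =
      trans (ℤ.div-pos-is-/ℕ (+ a) (suc d-1)) (cong +_ (k*n≤m<[1+k]*n⇒m/n≡k lower upper))

  ½<1 : ½ < 1ℚ
  ½<1 = from-yes (½ <? 1ℚ)

  0≤½ : 0ℚ ≤ ½
  0≤½ = from-yes (0ℚ ≤? ½)

  p≤p+q : ∀ {p q} → 0ℚ ≤ q → p ≤ p + q
  p≤p+q {p} {q} 0≤q = subst (_≤ p + q) (+-identityʳ p) (+-monoʳ-≤ p 0≤q)

  p≤q⇒0≤q-p : ∀ {p q} → p ≤ q → 0ℚ ≤ q - p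
  p≤q⇒0≤q-p {p} {q} p≤q = subst (_≤ q - p) (+-inverseʳ p) (+-monoˡ-≤ (- p) p≤q)

  0≤q-p⇒p≤q : ∀ {p q} → 0ℚ ≤ q - p → p ≤ q
  0≤q-p⇒p≤q {p} {q} 0≤q-p = subst₂ _≤_ (+-identityˡ p) q-p+p≡q (+-monoˡ-≤ p 0≤q-p)
    where
    q-p+p≡q : q - p + p ≡ q
    q-p+p≡q = trans (+-assoc q (- p) p) (trans (cong (λ x → q + x) (+-inverseˡ p)) (+-identityʳ q))

  floor[ιa+f]≡a : ∀ a f → 0ℚ ≤ f → f < 1ℚ → floor (ι a + f) ≡ + a
  floor[ιa+f]≡a a f 0≤f f<1 = floor-unique a (ι a + f) (p≤p+q 0≤f)
    (subst (ι a + f <_) (trans (+-comm (ι a) 1ℚ) (sym (ι-homo-+ 1 a))) (+-monoʳ-< (ι a) f<1))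

  p*q÷q≡p : ∀ p q .{{_ : NonZero q}} → (p * q) ÷ q ≡ p
  p*q÷q≡p p q = begin
    p * q * 1/ q   ≡⟨ *-assoc p q (1/ q) ⟩
    p * (q * 1/ q) ≡⟨ cong (p *_) (*-inverseʳ q) ⟩
    p * 1ℚ         ≡⟨ *-identityʳ p ⟩
    p              ∎
    where open ≡-Reasoning

  slope⇒triangularSeq : ∀ (λ′ : ℕ → ℕ) r d → Positive r → Positive d →
    (∀ j → 1 ℕ.≤ j → ι j * d ≤ r → floor (r - ι j * d) ≡ + λ′ j) →
    (∀ j → 1 ℕ.≤ j → r < ι j * d → λ′ j ≡ 0) →
    TriangularSeq λ′
  slope⇒triangularSeq λ′ r d r>0 d>0 below above = r , s , r>0 , s>0 , λ j 1≤j →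
      (λ j≤s → subst (λ x → floor (r - x) ≡ + λ′ j) (sym (jr÷s≡jd j)) (below j 1≤j
         (subst (ι j * d ≤_) s*d≡r (*-monoʳ-≤-nonNeg d {{pos⇒nonNeg d {{d>0}}}} j≤s))))
    , (λ s<j → above j 1≤j (subst (_< ι j * d) s*d≡r (*-monoˡ-<-pos d {{d>0}} s<j)))
    where
    instance
      d≢0 : NonZero d
      d≢0 = pos⇒nonZero d {{d>0}}
    s : ℚ
    s = r ÷ d
    s>0 : Positive s
    s>0 = pos*pos⇒pos r {{r>0}} (1/ d) {{1/pos⇒pos d {{d>0}}}}
    instance
      s≢0 : NonZero s
      s≢0 = pos⇒nonZero s {{s>0}}
    s*d≡r : s * d ≡ r
    s*d≡r = begin
      r * 1/ d * d   ≡⟨ *-assoc r (1/ d) d ⟩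
      r * (1/ d * d) ≡⟨ cong (r *_) (*-inverseˡ d) ⟩
      r * 1ℚ         ≡⟨ *-identityʳ r ⟩
      r              ∎
      where open ≡-Reasoning
    jr÷s≡jd : ∀ j → (ι j * r) ÷ s ≡ ι j * d
    jr÷s≡jd j = begin
      (ι j * r) ÷ s       ≡⟨ cong (λ x → (ι j * x) ÷ s) (sym s*d≡r) ⟩
      (ι j * (s * d)) ÷ s ≡⟨ cong (_÷ s) (trans (cong (ι j *_) (*-comm s d)) (sym (*-assoc (ι j) d s))) ⟩
      (ι j * d * s) ÷ s   ≡⟨ p*q÷q≡p (ι j * d) s ⟩
      ι j * d             ∎
      where open ≡-Reasoning

  triangularSeq-parts2 : ∀ n e c → suc e ≡ n ℕ.+ c → TriangularSeq (parts2 (n ℕ.+ e) n)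
  triangularSeq-parts2 n e c 1+e≡n+c = slope⇒triangularSeq (parts2 (n ℕ.+ e) n) r d r>0 d>0 below above
    where
    open +-*-Solver
    d r : ℚ
    d = ι e + ½
    r = ι n + ι 2 * d
    d>0 : Positive d
    d>0 = nonNeg+pos⇒pos (ι e) {{ι-nonNeg e}} ½
    r>0 : Positive r
    r>0 = nonNeg+pos⇒pos (ι n) {{ι-nonNeg n}} (ι 2 * d) {{pos*pos⇒pos (ι 2) d {{d>0}}}}
    gap₁ : r - ι 1 * d ≡ ι (n ℕ.+ e) + ½
    gap₁ = begin
      r - ι 1 * d
        ≡⟨ solve 2 (λ N E → N :+ con (ι 2) :* (E :+ con ½) :- con (ι 1) :* (E :+ con ½) := N :+ E :+ con ½)
                 refl (ι n) (ι e) ⟩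
      ι n + ι e + ½
        ≡⟨ cong (_+ ½) (sym (ι-homo-+ n e)) ⟩
      ι (n ℕ.+ e) + ½ ∎
      where open ≡-Reasoning
    gap₂ : r - ι 2 * d ≡ ι n + 0ℚ
    gap₂ = solve 2 (λ N E → N :+ con (ι 2) :* (E :+ con ½) :- con (ι 2) :* (E :+ con ½) := N :+ con 0ℚ)
                   refl (ι n) (ι e)
    gap₃ : ∀ t → r - ι (3 ℕ.+ t) * d + (ι c + ι t * d) ≡ ½
    gap₃ t = begin
      r - ι (3 ℕ.+ t) * d + (ι c + ι t * d)
        ≡⟨ cong (λ x → r - x * d + (ι c + ι t * d)) (ι-homo-+ 3 t) ⟩
      r - (ι 3 + ι t) * d + (ι c + ι t * d)
        ≡⟨ solve 4 (λ N E C T → N :+ con (ι 2) :* (E :+ con ½) :- (con (ι 3) :+ T) :* (E :+ con ½)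
                                  :+ (C :+ T :* (E :+ con ½))
                                := N :+ C :- E :- con ½)
                 refl (ι n) (ι e) (ι c) (ι t) ⟩
      ι n + ι c - ι e - ½
        ≡⟨ cong (λ x → x - ι e - ½) n+c≡1+e ⟩
      1ℚ + ι e - ι e - ½
        ≡⟨ solve 1 (λ E → con 1ℚ :+ E :- E :- con ½ := con ½) refl (ι e) ⟩
      ½ ∎
      where
      open ≡-Reasoning
      n+c≡1+e : ι n + ι c ≡ 1ℚ + ι e
      n+c≡1+e = trans (sym (ι-homo-+ n c)) (trans (cong ι (sym 1+e≡n+c)) (ι-homo-+ 1 e))
    0≤gap₁ : 0ℚ ≤ r - ι 1 * d
    0≤gap₁ = subst (0ℚ ≤_) (sym gap₁) (+-mono-≤ (0≤ι (n ℕ.+ e)) 0≤½)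
    0≤gap₂ : 0ℚ ≤ r - ι 2 * d
    0≤gap₂ = subst (0ℚ ≤_) (sym gap₂) (+-mono-≤ (0≤ι n) ≤-refl)
    below : ∀ j → 1 ℕ.≤ j → ι j * d ≤ r → floor (r - ι j * d) ≡ + parts2 (n ℕ.+ e) n j
    below 1 _ _ = subst (λ x → floor x ≡ + (n ℕ.+ e)) (sym gap₁) (floor[ιa+f]≡a (n ℕ.+ e) ½ 0≤½ ½<1)
    below 2 _ _ = subst (λ x → floor x ≡ + n) (sym gap₂) (floor[ιa+f]≡a n 0ℚ ≤-refl (from-yes (0ℚ <? 1ℚ)))
    below (suc (suc (suc t))) _ jd≤r = floor-unique 0 _ (p≤q⇒0≤q-p jd≤r) (≤-<-trans gap₃≤½ ½<1)
      where
      0≤td : 0ℚ ≤ ι t * d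
      0≤td = subst (_≤ ι t * d) (*-zeroˡ d) (*-monoʳ-≤-nonNeg d {{pos⇒nonNeg d {{d>0}}}} (0≤ι t))
      gap₃≤½ : r - ι (3 ℕ.+ t) * d ≤ ½
      gap₃≤½ = subst (r - ι (3 ℕ.+ t) * d ≤_) (gap₃ t) (p≤p+q (+-mono-≤ (0≤ι c) 0≤td))
    above : ∀ j → 1 ℕ.≤ j → r < ι j * d → parts2 (n ℕ.+ e) n j ≡ 0
    above 1 _ r<d = ⊥-elim (<-irrefl refl (<-≤-trans r<d (0≤q-p⇒p≤q 0≤gap₁)))
    above 2 _ r<2d = ⊥-elim (<-irrefl refl (<-≤-trans r<2d (0≤q-p⇒p≤q 0≤gap₂)))
    above (suc (suc (suc t))) _ _ = refl

  2n≤1+m⇒triangular2 : ∀ {m n} → 2 ℕ.* n ℕ.≤ suc m → Triangular2 m n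
  2n≤1+m⇒triangular2 {m} {zero} _ = ℕ.z≤n , triangularSeq-parts2 0 m (suc m) refl
  2n≤1+m⇒triangular2 {m} {suc n} 2n≤1+m with c , 2n+c≡1+m ← ℕ.m≤n⇒∃[o]m+o≡n 2n≤1+m =
    subst (λ m → Triangular2 m (suc n)) m≡ (ℕ.m≤m+n (suc n) (n ℕ.+ c) , triangularSeq-parts2 (suc n) (n ℕ.+ c) c refl)
    where
    m≡ : suc n ℕ.+ (n ℕ.+ c) ≡ m
    m≡ = ℕ.suc-injective (trans shift 2n+c≡1+m)
      where
      shift : suc (suc n ℕ.+ (n ℕ.+ c)) ≡ 2 ℕ.* suc n ℕ.+ c
      shift = ℕ-Solver.solve (n ∷ c ∷ [])

open TriangularShapes using (2n≤1+m⇒triangular2)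
open import Data.Nat using (_+_; _*_; _∸_; _≤_; _≰_; _≤?_; z≤n; s≤s)
open import Data.Nat.Properties
open import Data.Nat.Tactic.RingSolver using (solve)
open import Data.List using (List; []; _∷_; [_]; _++_; filter; length; iterate; applyUpTo; map; upTo)
open import Data.List.Properties
  using (filter-accept; filter-reject; filter-all; filter-none; filter-++; ++-identityʳ; applyUpTo-∷ʳ; map-applyUpTo; length-iterate)
open import Data.List.Relation.Unary.All as All using (All)
open import Data.List.Relation.Unary.All.Properties using (applyUpTo⁺₁)
open import Data.List.Relation.Unary.Any using (here; there)
open import Data.List.Membership.DecPropositional Data.Nat._≟_ using (_∈?_; _∈_; _∉_)
open import Data.List.Membership.Propositional.Properties using (∈-filter⁺; ∈-filter⁻)
open import Data.Sum using (inj₁; inj₂)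
open import Function using (_∘_)
open import Relation.Nullary using (Dec; yes; no)
open import Relation.Unary.Properties using (∁?)

everyOther : ℕ → ℕ → List ℕ
everyOther = iterate (2 +_)

applyUpTo≡iterate : ∀ (f g : ℕ → ℕ) n → (∀ t → f (suc t) ≡ g (f t)) → applyUpTo f n ≡ iterate g (f 0) n
applyUpTo≡iterate f g zero step = refl
applyUpTo≡iterate f g (suc n) step =
  cong (f 0 ∷_) (trans (applyUpTo≡iterate (λ t → f (suc t)) g n (λ t → step (suc t)))
                       (cong (λ x → iterate g x n) (step 0)))

labels≡iterate : ∀ N → labels N ≡ iterate suc 1 N
labels≡iterate N = applyUpTo≡iterate suc suc N (λ _ → refl)

upperRR≡everyOther : ∀ n i → upperRR n i ≡ everyOther (n + i) n
upperRR≡everyOther n i = begin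
  map f (upTo n)          ≡⟨ map-applyUpTo (λ t → t) f n ⟩
  applyUpTo f n           ≡⟨ applyUpTo≡iterate f (2 +_) n step ⟩
  everyOther (f 0) n      ≡⟨ cong (λ x → everyOther x n) (+-identityʳ (n + i)) ⟩
  everyOther (n + i) n    ∎
  where
  open ≡-Reasoning
  f : ℕ → ℕ
  f t = n + i + 2 * t
  step : ∀ t → n + i + 2 * suc t ≡ 2 + (n + i + 2 * t)
  step t = solve (n ∷ i ∷ t ∷ [])

iterate-lowerBound : ∀ {f : ℕ → ℕ} → (∀ x → x ≤ f x) → ∀ a l → All (a ≤_) (iterate f a l)
iterate-lowerBound f-infl a zero = All.[]
iterate-lowerBound f-infl a (suc l) =
  ≤-refl All.∷ All.map (≤-trans (f-infl a)) (iterate-lowerBound f-infl _ l)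

everyOther-lowerBound : ∀ c p → All (c ≤_) (everyOther c p)
everyOther-lowerBound = iterate-lowerBound (λ x → m≤n+m x 2)

filter-≤-everyOther : ∀ k c n → c ≤ k + 2 →
  Σ ℕ λ p → p ≤ n × c + 2 * p ≤ k + 2 × filter (_≤? k) (everyOther c n) ≡ everyOther c p
filter-≤-everyOther k c zero c≤k+2 = 0 , z≤n , subst (_≤ k + 2) (sym (+-identityʳ c)) c≤k+2 , refl
filter-≤-everyOther k c (suc n) c≤k+2 with c ≤? k
... | yes c≤k =
  let p , p≤n , bound , eq = filter-≤-everyOther k (2 + c) n (subst (_≤ k + 2) (+-comm c 2) (+-monoˡ-≤ 2 c≤k))
  in suc p , s≤s p≤n , subst (_≤ k + 2) (shift p) bound , trans (filter-accept (_≤? k) c≤k) (cong (c ∷_) eq)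
  where
  shift : ∀ p → 2 + c + 2 * p ≡ c + 2 * suc p
  shift p = solve (c ∷ p ∷ [])
... | no c≰k = 0 , z≤n , subst (_≤ k + 2) (sym (+-identityʳ c)) c≤k+2 ,
  trans (filter-reject (_≤? k) c≰k) (filter-none (_≤? k) (All.map tail-rejected (everyOther-lowerBound (2 + c) n)))
  where
  tail-rejected : ∀ {x} → 2 + c ≤ x → x ≰ k
  tail-rejected 2+c≤x x≤k = c≰k (≤-trans (m≤n+m c 2) (≤-trans 2+c≤x x≤k))

filter-≤-filter-∉ : ∀ k U xs →
  filter (_≤? k) (filter (∁? (_∈? U)) xs) ≡ filter (∁? (_∈? filter (_≤? k) U)) (filter (_≤? k) xs)
filter-≤-filter-∉ k U [] = refl
filter-≤-filter-∉ k U (x ∷ xs) = step (x ≤? k) (x ∈? U)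
  where
  open ≡-Reasoning
  ≤k? = _≤? k
  ∉U? = ∁? (_∈? U)
  ∉U′? = ∁? (_∈? filter ≤k? U)
  ih = filter-≤-filter-∉ k U xs
  step : Dec (x ≤ k) → Dec (x ∈ U) →
    filter ≤k? (filter ∉U? (x ∷ xs)) ≡ filter ∉U′? (filter ≤k? (x ∷ xs))
  step (yes x≤k) (yes x∈U) = begin
    filter ≤k? (filter ∉U? (x ∷ xs)) ≡⟨ cong (filter ≤k?) (filter-reject ∉U? (λ x∉U → x∉U x∈U)) ⟩
    filter ≤k? (filter ∉U? xs)       ≡⟨ ih ⟩
    filter ∉U′? (filter ≤k? xs)      ≡⟨ filter-reject ∉U′? (λ x∉U′ → x∉U′ (∈-filter⁺ ≤k? x∈U x≤k)) ⟨
    filter ∉U′? (x ∷ filter ≤k? xs)  ≡⟨ cong (filter ∉U′?) (filter-accept ≤k? x≤k) ⟨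
    filter ∉U′? (filter ≤k? (x ∷ xs)) ∎
  step (yes x≤k) (no x∉U) = begin
    filter ≤k? (filter ∉U? (x ∷ xs))   ≡⟨ cong (filter ≤k?) (filter-accept ∉U? x∉U) ⟩
    filter ≤k? (x ∷ filter ∉U? xs)     ≡⟨ filter-accept ≤k? x≤k ⟩
    x ∷ filter ≤k? (filter ∉U? xs)     ≡⟨ cong (x ∷_) ih ⟩
    x ∷ filter ∉U′? (filter ≤k? xs)    ≡⟨ filter-accept ∉U′? (λ x∈U′ → x∉U (proj₁ (∈-filter⁻ ≤k? x∈U′))) ⟨
    filter ∉U′? (x ∷ filter ≤k? xs)    ≡⟨ cong (filter ∉U′?) (filter-accept ≤k? x≤k) ⟨
    filter ∉U′? (filter ≤k? (x ∷ xs))  ∎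
  step (no x≰k) (yes x∈U) = begin
    filter ≤k? (filter ∉U? (x ∷ xs))  ≡⟨ cong (filter ≤k?) (filter-reject ∉U? (λ x∉U → x∉U x∈U)) ⟩
    filter ≤k? (filter ∉U? xs)        ≡⟨ ih ⟩
    filter ∉U′? (filter ≤k? xs)       ≡⟨ cong (filter ∉U′?) (filter-reject ≤k? x≰k) ⟨
    filter ∉U′? (filter ≤k? (x ∷ xs)) ∎
  step (no x≰k) (no x∉U) = begin
    filter ≤k? (filter ∉U? (x ∷ xs))  ≡⟨ cong (filter ≤k?) (filter-accept ∉U? x∉U) ⟩
    filter ≤k? (x ∷ filter ∉U? xs)    ≡⟨ filter-reject ≤k? x≰k ⟩
    filter ≤k? (filter ∉U? xs)        ≡⟨ ih ⟩
    filter ∉U′? (filter ≤k? xs)       ≡⟨ cong (filter ∉U′?) (filter-reject ≤k? x≰k) ⟨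
    filter ∉U′? (filter ≤k? (x ∷ xs)) ∎

filter-≤-labels : ∀ {k} N → k ≤ N → filter (_≤? k) (labels N) ≡ labels k
filter-≤-labels {k} N k≤N with m≤n⇒m<n∨m≡n k≤N
... | inj₂ refl = filter-all (_≤? k) (applyUpTo⁺₁ suc k (λ i<k → i<k))
filter-≤-labels {k} (suc N) k≤N | inj₁ k<1+N = begin
  filter (_≤? k) (labels (suc N))
    ≡⟨ cong (filter (_≤? k)) (applyUpTo-∷ʳ suc N) ⟨
  filter (_≤? k) (labels N ++ [ suc N ])
    ≡⟨ filter-++ (_≤? k) (labels N) [ suc N ] ⟩
  filter (_≤? k) (labels N) ++ filter (_≤? k) [ suc N ]
    ≡⟨ cong (filter (_≤? k) (labels N) ++_) (filter-reject (_≤? k) (<⇒≱ k<1+N)) ⟩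
  filter (_≤? k) (labels N) ++ []
    ≡⟨ ++-identityʳ _ ⟩
  filter (_≤? k) (labels N)
    ≡⟨ filter-≤-labels N (≤-pred k<1+N) ⟩
  labels k ∎
  where open ≡-Reasoning

filter-∉-∷ : ∀ {x} U ys → x ∉ ys → filter (∁? (_∈? x ∷ U)) ys ≡ filter (∁? (_∈? U)) ys
filter-∉-∷ U [] x∉ys = refl
filter-∉-∷ {x} U (y ∷ ys) x∉y∷ys = step (y ∈? U)
  where
  ih = filter-∉-∷ U ys (x∉y∷ys ∘ there)
  step : Dec (y ∈ U) → filter (∁? (_∈? x ∷ U)) (y ∷ ys) ≡ filter (∁? (_∈? U)) (y ∷ ys)
  step (yes y∈U) = trans (filter-reject (∁? (_∈? x ∷ U)) (λ y∉x∷U → y∉x∷U (there y∈U)))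
    (trans ih (sym (filter-reject (∁? (_∈? U)) (λ y∉U → y∉U y∈U))))
  step (no y∉U) = trans (filter-accept (∁? (_∈? x ∷ U)) y∉x∷U)
    (trans (cong (y ∷_) ih) (sym (filter-accept (∁? (_∈? U)) y∉U)))
    where
    y∉x∷U : y ∉ x ∷ U
    y∉x∷U (here y≡x) = x∉y∷ys (here (sym y≡x))
    y∉x∷U (there y∈U) = y∉U y∈U

-- The bound says that the last term c + 2(p-1) lies below a + l.
length-filter-∉-everyOther : ∀ {a c} l p → a ≤ c → c + 2 * p ≤ suc (a + l) →
  length (filter (∁? (_∈? everyOther c p)) (iterate suc a l)) + p ≡ l
length-filter-∉-everyOther {a} l zero _ _ = begin
  length (filter (∁? (_∈? [])) (iterate suc a l)) + 0 ≡⟨ +-identityʳ _ ⟩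
  length (filter (∁? (_∈? [])) (iterate suc a l))     ≡⟨ cong length nothing-excluded ⟩
  length (iterate suc a l)                             ≡⟨ length-iterate suc a l ⟩
  l                                                    ∎
  where
  open ≡-Reasoning
  nothing-excluded : filter (∁? (_∈? [])) (iterate suc a l) ≡ iterate suc a l
  nothing-excluded = filter-all (∁? (_∈? [])) (All.universal (λ _ ()) _)
length-filter-∉-everyOther {a} {c} zero (suc p) a≤c bound = ⊥-elim (<-irrefl refl (begin-strict
  suc (a + 0)           ≡⟨ cong suc (+-identityʳ a) ⟩
  suc a                 ≤⟨ s≤s a≤c ⟩
  suc c                 <⟨ s≤s (s≤s (m≤m+n c (2 * p))) ⟩
  suc (suc (c + 2 * p)) ≡⟨ solve (c ∷ p ∷ []) ⟩
  c + 2 * suc p         ≤⟨ bound ⟩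
  suc (a + 0)           ∎))
  where open ≤-Reasoning
length-filter-∉-everyOther {a} {c} (suc l) (suc p) a≤c bound with m≤n⇒m<n∨m≡n a≤c
... | inj₂ refl = begin
  length (filter ∉U? (a ∷ ys)) + suc p ≡⟨ cong (λ zs → length zs + suc p) (filter-reject ∉U? (λ a∉U → a∉U (here refl))) ⟩
  length (filter ∉U? ys) + suc p       ≡⟨ cong (λ zs → length zs + suc p) (filter-∉-∷ (everyOther (2 + a) p) ys a∉ys) ⟩
  length (filter ∉U′? ys) + suc p      ≡⟨ +-suc _ p ⟩
  suc (length (filter ∉U′? ys) + p)    ≡⟨ cong suc (length-filter-∉-everyOther l p (n≤1+n (suc a)) bound′) ⟩
  suc l                                ∎
  where
  open ≡-Reasoning
  ys = iterate suc (suc a) l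
  ∉U? = ∁? (_∈? everyOther a (suc p))
  ∉U′? = ∁? (_∈? everyOther (2 + a) p)
  a∉ys : a ∉ ys
  a∉ys a∈ys = <-irrefl refl (All.lookup (iterate-lowerBound n≤1+n (suc a) l) a∈ys)
  bound′ : 2 + a + 2 * p ≤ suc (suc a + l)
  bound′ = subst₂ _≤_ shift (cong suc (+-suc a l)) bound
    where
    shift : a + 2 * suc p ≡ 2 + a + 2 * p
    shift = solve (a ∷ p ∷ [])
... | inj₁ a<c = begin
  length (filter ∉U? (a ∷ ys)) + suc p ≡⟨ cong (λ zs → length zs + suc p) (filter-accept ∉U? a∉U) ⟩
  suc (length (filter ∉U? ys) + suc p) ≡⟨ cong suc (length-filter-∉-everyOther l (suc p) a<c bound′) ⟩
  suc l                                ∎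
  where
  open ≡-Reasoning
  ys = iterate suc (suc a) l
  ∉U? = ∁? (_∈? everyOther c (suc p))
  a∉U : a ∉ everyOther c (suc p)
  a∉U a∈U = <⇒≱ a<c (All.lookup (everyOther-lowerBound c (suc p)) a∈U)
  bound′ : c + 2 * suc p ≤ suc (suc a + l)
  bound′ = subst (c + 2 * suc p ≤_) (cong suc (+-suc a l)) bound

rowLen₁-rowRegular : ∀ {m n i} → ValidIndex m n i → rowLen₁ (rowRegular m n i) ≡ m
rowLen₁-rowRegular {m} {n} {i} (1≤i , i+2n≤m+2) = +-cancelʳ-≡ n _ m (begin
  length (filter (∁? (_∈? upperRR n i)) (labels (m + n))) + n
    ≡⟨ cong₂ (λ U xs → length (filter (∁? (_∈? U)) xs) + n) (upperRR≡everyOther n i) (labels≡iterate (m + n)) ⟩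
  length (filter (∁? (_∈? everyOther (n + i) n)) (iterate suc 1 (m + n))) + n
    ≡⟨ length-filter-∉-everyOther (m + n) n (≤-trans 1≤i (m≤n+m i n)) bound ⟩
  m + n ∎)
  where
  open ≡-Reasoning
  bound : n + i + 2 * n ≤ suc (1 + (m + n))
  bound = subst₂ _≤_ (sym (+-assoc n i (2 * n))) shift (+-monoʳ-≤ n i+2n≤m+2)
    where
    shift : n + (m + 2) ≡ suc (1 + (m + n))
    shift = solve (m ∷ n ∷ [])

rowLen₂-rowRegular : ∀ m n i → rowLen₂ (rowRegular m n i) ≡ n
rowLen₂-rowRegular m n i = trans (cong length (upperRR≡everyOther n i)) (length-iterate (2 +_) (n + i) n)

validIndex⇒2n≤1+m : ∀ {m n i} → ValidIndex m n i → 2 * n ≤ suc m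
validIndex⇒2n≤1+m {m} {n} {i} (1≤i , i+2n≤m+2) =
  ≤-pred (≤-trans (+-monoˡ-≤ (2 * n) 1≤i) (subst (i + 2 * n ≤_) (+-comm m 2) i+2n≤m+2))

TriangularRowRegular : Tableau2 → Set
TriangularRowRegular θ =
  Triangular2 (rowLen₁ θ) (rowLen₂ θ)
  × Σ ℕ (λ i′ → ValidIndex (rowLen₁ θ) (rowLen₂ θ) i′ × θ ≡ rowRegular (rowLen₁ θ) (rowLen₂ θ) i′)

rowRegular-triangularRowRegular : ∀ {m n i} → ValidIndex m n i → TriangularRowRegular (rowRegular m n i)
rowRegular-triangularRowRegular {m} {n} {i} valid =
  subst₂ (λ a b → Triangular2 a b × Σ ℕ (λ i′ → ValidIndex a b i′ × rowRegular m n i ≡ rowRegular a b i′))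
    (sym (rowLen₁-rowRegular valid)) (sym (rowLen₂-rowRegular m n i))
    (2n≤1+m⇒triangular2 (validIndex⇒2n≤1+m {m} {n} valid) , i , valid , refl)

restricted-validIndex : ∀ {n i k p m′ i′} → 1 ≤ i → p ≤ n → n + i + 2 * p ≤ k + 2 →
  k ≡ m′ + p → n + i ≡ p + i′ → ValidIndex m′ p i′
restricted-validIndex {n} {i} {k} {p} {m′} {i′} 1≤i p≤n bound k≡m′+p n+i≡p+i′ =
  +-cancelˡ-≤ p 1 i′ (subst (p + 1 ≤_) n+i≡p+i′ (+-mono-≤ p≤n 1≤i)) ,
  +-cancelˡ-≤ p (i′ + 2 * p) (m′ + 2) (begin
    p + (i′ + 2 * p) ≡⟨ +-assoc p i′ (2 * p) ⟨
    p + i′ + 2 * p   ≡⟨ cong (_+ 2 * p) n+i≡p+i′ ⟨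
    n + i + 2 * p    ≤⟨ bound ⟩
    k + 2            ≡⟨ cong (_+ 2) k≡m′+p ⟩
    m′ + p + 2       ≡⟨ solve (m′ ∷ p ∷ []) ⟩
    p + (m′ + 2)     ∎)
  where open ≤-Reasoning

restrict-rowRegular : ∀ {m n i k} → 1 ≤ i → n + i ≤ k → k ≤ m + n →
  Σ ℕ λ m′ → Σ ℕ λ n′ → Σ ℕ λ i′ → ValidIndex m′ n′ i′ × restrict k (rowRegular m n i) ≡ rowRegular m′ n′ i′
restrict-rowRegular {m} {n} {i} {k} 1≤i n+i≤k k≤m+n
  with p , p≤n , bound , upper-kept ← filter-≤-everyOther k (n + i) n (≤-trans n+i≤k (m≤m+n k 2)) =
  m′ , p , i′ , restricted-validIndex 1≤i p≤n bound k≡m′+p n+i≡p+i′ , cong₂ tab bottom upper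
  where
  open ≡-Reasoning
  m′ i′ : ℕ
  m′ = k ∸ p
  i′ = n + i ∸ p
  p≤n+i : p ≤ n + i
  p≤n+i = ≤-trans p≤n (m≤m+n n i)
  k≡m′+p : k ≡ m′ + p
  k≡m′+p = sym (m∸n+n≡m (≤-trans p≤n+i n+i≤k))
  n+i≡p+i′ : n + i ≡ p + i′
  n+i≡p+i′ = sym (m+[n∸m]≡n p≤n+i)
  upper : filter (_≤? k) (upperRR n i) ≡ upperRR p i′
  upper = begin
    filter (_≤? k) (upperRR n i)          ≡⟨ cong (filter (_≤? k)) (upperRR≡everyOther n i) ⟩
    filter (_≤? k) (everyOther (n + i) n) ≡⟨ upper-kept ⟩
    everyOther (n + i) p                  ≡⟨ cong (λ c → everyOther c p) n+i≡p+i′ ⟩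
    everyOther (p + i′) p                 ≡⟨ upperRR≡everyOther p i′ ⟨
    upperRR p i′                          ∎
  bottom : filter (_≤? k) (filter (∁? (_∈? upperRR n i)) (labels (m + n)))
         ≡ filter (∁? (_∈? upperRR p i′)) (labels (m′ + p))
  bottom = begin
    filter (_≤? k) (filter (∁? (_∈? upperRR n i)) (labels (m + n)))
      ≡⟨ filter-≤-filter-∉ k (upperRR n i) (labels (m + n)) ⟩
    filter (∁? (_∈? filter (_≤? k) (upperRR n i))) (filter (_≤? k) (labels (m + n)))
      ≡⟨ cong₂ (λ U xs → filter (∁? (_∈? U)) xs) upper (filter-≤-labels (m + n) k≤m+n) ⟩
    filter (∁? (_∈? upperRR p i′)) (labels k)
      ≡⟨ cong (λ N → filter (∁? (_∈? upperRR p i′)) (labels N)) k≡m′+p ⟩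
    filter (∁? (_∈? upperRR p i′)) (labels (m′ + p)) ∎

proposition4p9 : (m n i : ℕ) → Triangular2 m n → ValidIndex m n i →
    (k : ℕ) → n + i ≤ k → k ≤ m + n →
    Triangular2 (rowLen₁ (restrict k (rowRegular m n i))) (rowLen₂ (restrict k (rowRegular m n i)))
    × Σ ℕ (λ i′ → ValidIndex (rowLen₁ (restrict k (rowRegular m n i))) (rowLen₂ (restrict k (rowRegular m n i))) i′
        × restrict k (rowRegular m n i) ≡ rowRegular (rowLen₁ (restrict k (rowRegular m n i))) (rowLen₂ (restrict k (rowRegular m n i))) i′)
proposition4p9 m n i _ (1≤i , _) k n+i≤k k≤m+n
  with m′ , n′ , i′ , valid , restriction ← restrict-rowRegular {m} 1≤i n+i≤k k≤m+n =
  subst TriangularRowRegular (sym restriction) (rowRegular-triangularRowRegular valid)
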